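{- Let $x$ and $y$ be two variables with $x \neq y$. Then there exists a prelambda congruence $\sim$ on $\mathbb{T}$ such that $\lambda x x \not\sim \lambda y y$ (i.e. $([\lambda x x],[\lambda y y]) \notin\, \sim$).
   Context: Let $\mathbb{V}$ be an infinite set whose elements are called variables. The set $\mathbb{T}$ of terms is the set of words inductively defined by: every variable $x$ is a term; if $A,B$ are terms then $[AB]$ is a term (application); if $x$ is a variable and $A$ is a term then $[\lambda x A]$ is a term (abstraction). Equality of terms is syntactic identity of words (no identification up to renaming of bound variables). We abbreviate $[AB]$ as $AB$ and $[\lambda x A]$ as $\lambda x A$. A binary relation $\sim$ on $\mathbb{T}$ is a congruence if it is reflexive, symmetric, transitive, and for all terms $A,B,C,D$ and every variable $x$: $A\sim B$ implies $\lambda x A \sim \lambda x B$, and $A\sim B$, $C \sim D$ imply $AC \sim BD$. A prelambda congruence is a congruence $\sim$ such that for all terms $A,B,D$ and all variables $x,y$: ($\beta_1$) $[\lambda x x]D \sim D$; ($\beta_2$) $[\lambda x y]D \sim y$ whenever $x\neq y$; ($\beta_3$) $[\lambda x[AB]]D \sim [[\lambda x A]D][[\lambda x B]D]$; ($\beta_4$) $[\lambda x[\lambda x A]]D \sim \lambda x A$; ($\beta_5$) if $x \neq y$ and $[\lambda y D]x \sim D$, then $[\lambda x[\lambda y A]]D \sim \lambda y[[\lambda x A]D]$. -}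

module Defs where

open import Data.Nat using (ℕ)
open import Data.Product using (Σ)
open import Relation.Binary.PropositionalEquality using (_≡_)
open import Relation.Nullary using (¬_)
open import Function.Definitions using (Injective)

-- Lambda terms over a set V of variables, *not* identified up to alpha.
data Term (V : Set) : Set where
  var : V → Term V
  app : Term V → Term V → Term V
  lam : V → Term V → Term V

Infinite : Set → Set
Infinite V = Σ (ℕ → V) (λ f → Injective _≡_ _≡_ f)

module _ {V : Set} (_∼_ : Term V → Term V → Set) where

  record IsCongruence : Set where
    field
      refl′  : ∀ A → A ∼ A
      sym′   : ∀ {A B} → A ∼ B → B ∼ A
      trans′ : ∀ {A B C} → A ∼ B → B ∼ C → A ∼ C
      lam-cong : ∀ {A B} x → A ∼ B → lam x A ∼ lam x B
      app-cong : ∀ {A B C D} → A ∼ B → C ∼ D → app A C ∼ app B D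

  record IsPrelambdaCongruence : Set where
    field
      isCongruence : IsCongruence
      β₁ : ∀ x D → app (lam x (var x)) D ∼ D
      β₂ : ∀ x y D → ¬ (x ≡ y) → app (lam x (var y)) D ∼ var y
      β₃ : ∀ x A B D →
           app (lam x (app A B)) D ∼ app (app (lam x A) D) (app (lam x B) D)
      β₄ : ∀ x A D → app (lam x (lam x A)) D ∼ lam x A
      β₅ : ∀ x y A D → ¬ (x ≡ y) → app (lam y D) (var x) ∼ D →
           app (lam x (lam y A)) D ∼ lam y (app (lam x A) D)

-- Terms are interpreted as sets of codes in a relational graph-style model:
-- a code e ↦ m of an abstraction λz A records that A yields m when z is bound
-- to the finite set e, and in addition λz A contains the code binder z.
-- Environments bind variables to finite sets with the innermost binding
-- shadowing outer ones, which validates β₁–β₅ literally, without renaming.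
-- The binder codes separate λx x from λy y.

module Submission where

open import Defs
open import Relation.Binary.PropositionalEquality using (_≡_; _≢_; refl; ≢-sym)
open import Relation.Nullary using (¬_)
open import Data.Product using (Σ; ∃-syntax; _×_; _,_)
open import Data.Sum using (_⊎_; inj₁; inj₂)
open import Data.Empty using (⊥; ⊥-elim)
open import Data.List using (List; []; _∷_; _++_)
open import Data.List.Membership.Propositional using (_∈_)
open import Data.List.Relation.Binary.Subset.Propositional using (_⊆_)
open import Data.List.Relation.Binary.Subset.Propositional.Properties
  using (⊆-refl; xs⊆xs++ys; xs⊆ys++xs)
open import Data.List.Relation.Unary.Any using (here)
open import Data.List.Relation.Unary.All as All using (All; []; _∷_)
open import Data.List.Relation.Unary.All.Properties using (++⁺)
open import Function.Bundles using (_⇔_; mk⇔; Equivalence)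
open import Function.Construct.Identity using (⇔-id)
open import Function.Construct.Symmetry using (⇔-sym)
open import Function.Construct.Composition using (_⇔-∘_)

open Equivalence using (to; from)

merge-witnesses : ∀ {A : Set} {P : A → Set} (Q : List A → A → Set) →
                  (∀ {e E a} → e ⊆ E → Q e a → Q E a) →
                  ∀ {as} → All (λ a → ∃[ e ] All P e × Q e a) as →
                  ∃[ E ] All P E × All (Q E) as
merge-witnesses Q Q-mono [] = [] , [] , []
merge-witnesses Q Q-mono ((e , pe , q) ∷ rest) with merge-witnesses Q Q-mono rest
... | E , pE , qs =
  e ++ E , ++⁺ pe pE , Q-mono (xs⊆xs++ys e E) q ∷ All.map (Q-mono (xs⊆ys++xs E e)) qs

module Model (V : Set) where

  data Code : Set where
    binder : V → Code
    _↦_    : List Code → Code → Code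

  Env : Set
  Env = List (V × List Code)

  Lookup : Env → V → Code → Set
  Lookup []            v c = ⊥
  Lookup ((z , e) ∷ Γ) v c = (z ≡ v × c ∈ e) ⊎ (z ≢ v × Lookup Γ v c)

  ⟦_⟧ : Term V → Env → Code → Set
  ⟦ var v ⟧   Γ c          = Lookup Γ v c
  ⟦ app A B ⟧ Γ c          = ∃[ e ] All (⟦ B ⟧ Γ) e × ⟦ A ⟧ Γ (e ↦ c)
  ⟦ lam z A ⟧ Γ (binder w) = w ≡ z
  ⟦ lam z A ⟧ Γ (e ↦ m)    = ⟦ A ⟧ ((z , e) ∷ Γ) m

  Lookup-here : ∀ {x e Γ c} → Lookup ((x , e) ∷ Γ) x c ⇔ c ∈ e
  Lookup-here = mk⇔ (λ { (inj₁ (_ , c∈e)) → c∈e ; (inj₂ (x≢x , _)) → ⊥-elim (x≢x refl) })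
                    (λ c∈e → inj₁ (refl , c∈e))

  Lookup-there : ∀ {x y e Γ c} → x ≢ y → Lookup ((x , e) ∷ Γ) y c ⇔ Lookup Γ y c
  Lookup-there x≢y = mk⇔ (λ { (inj₁ (x≡y , _)) → ⊥-elim (x≢y x≡y) ; (inj₂ (_ , l)) → l })
                         (λ l → inj₂ (x≢y , l))

  _⊑_ : Env → Env → Set
  Γ ⊑ Δ = ∀ {v c} → Lookup Γ v c → Lookup Δ v c

  ⊑-∷ : ∀ z {e e′ Γ Δ} → e ⊆ e′ → Γ ⊑ Δ → ((z , e) ∷ Γ) ⊑ ((z , e′) ∷ Δ)
  ⊑-∷ z e⊆e′ Γ⊑Δ (inj₁ (z≡v , c∈e)) = inj₁ (z≡v , e⊆e′ c∈e)
  ⊑-∷ z e⊆e′ Γ⊑Δ (inj₂ (z≢v , l))   = inj₂ (z≢v , Γ⊑Δ l)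

  ⊑-∷ʳ : ∀ z {e e′ Γ} → e ⊆ e′ → ((z , e) ∷ Γ) ⊑ ((z , e′) ∷ Γ)
  ⊑-∷ʳ z e⊆e′ = ⊑-∷ z e⊆e′ (λ l → l)

  shadowed-drop : ∀ y {e e′ Γ} → ((y , e′) ∷ (y , e) ∷ Γ) ⊑ ((y , e′) ∷ Γ)
  shadowed-drop y (inj₁ l)                      = inj₁ l
  shadowed-drop y (inj₂ (y≢v , inj₁ (y≡v , _))) = ⊥-elim (y≢v y≡v)
  shadowed-drop y (inj₂ (y≢v , inj₂ (_ , l)))   = inj₂ (y≢v , l)

  shadowed-add : ∀ y {e e′ Γ} → ((y , e′) ∷ Γ) ⊑ ((y , e′) ∷ (y , e) ∷ Γ)
  shadowed-add y (inj₁ l)         = inj₁ l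
  shadowed-add y (inj₂ (y≢v , l)) = inj₂ (y≢v , inj₂ (y≢v , l))

  swap : ∀ {x y e e′ Γ} → x ≢ y → ((y , e′) ∷ (x , e) ∷ Γ) ⊑ ((x , e) ∷ (y , e′) ∷ Γ)
  swap x≢y (inj₁ (refl , c∈e′))          = inj₂ (x≢y , inj₁ (refl , c∈e′))
  swap x≢y (inj₂ (_ , inj₁ l))           = inj₁ l
  swap x≢y (inj₂ (y≢v , inj₂ (x≢v , l))) = inj₂ (x≢v , inj₂ (y≢v , l))

  ⟦⟧-mono : ∀ A {Γ Δ} → Γ ⊑ Δ → ∀ {c} → ⟦ A ⟧ Γ c → ⟦ A ⟧ Δ c
  ⟦⟧-mono (var v)   Γ⊑Δ l              = Γ⊑Δ l
  ⟦⟧-mono (app A B) Γ⊑Δ (e , bs , a)   = e , All.map (⟦⟧-mono B Γ⊑Δ) bs , ⟦⟧-mono A Γ⊑Δ a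
  ⟦⟧-mono (lam z A) Γ⊑Δ {binder w} w≡z = w≡z
  ⟦⟧-mono (lam z A) Γ⊑Δ {e ↦ m}    a   = ⟦⟧-mono A (⊑-∷ z ⊆-refl Γ⊑Δ) a

  lam-shadowed : ∀ y A {e Γ} c → ⟦ lam y A ⟧ ((y , e) ∷ Γ) c ⇔ ⟦ lam y A ⟧ Γ c
  lam-shadowed y A (binder w) = ⇔-id _
  lam-shadowed y A (e ↦ m)    = mk⇔ (⟦⟧-mono A (shadowed-drop y)) (⟦⟧-mono A (shadowed-add y))

  app-resp : ∀ A A′ B B′ {Γ Δ} →
             (∀ c → ⟦ A ⟧ Γ c ⇔ ⟦ A′ ⟧ Δ c) → (∀ c → ⟦ B ⟧ Γ c ⇔ ⟦ B′ ⟧ Δ c) →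
             ∀ c → ⟦ app A B ⟧ Γ c ⇔ ⟦ app A′ B′ ⟧ Δ c
  app-resp A A′ B B′ A⇔A′ B⇔B′ c =
    mk⇔ (λ (e , bs , a) → e , All.map (to (B⇔B′ _)) bs , to (A⇔A′ _) a)
        (λ (e , bs , a) → e , All.map (from (B⇔B′ _)) bs , from (A⇔A′ _) a)

  _≈_ : Term V → Term V → Set
  A ≈ B = ∀ Γ c → ⟦ A ⟧ Γ c ⇔ ⟦ B ⟧ Γ c

  -- Both sides agree with [λy D]x, whose λy hides the outer binding of y.
  binding-irrelevant : ∀ {x y} D → x ≢ y → app (lam y D) (var x) ≈ D →
                       ∀ e Γ c → ⟦ D ⟧ ((y , e) ∷ Γ) c ⇔ ⟦ D ⟧ Γ c
  binding-irrelevant {x} {y} D x≢y D-fresh e Γ c =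
    D-fresh Γ c
      ⇔-∘ (app-resp (lam y D) (lam y D) (var x) (var x) {Γ = (y , e) ∷ Γ}
             (lam-shadowed y D) (λ _ → Lookup-there (≢-sym x≢y)) c
           ⇔-∘ ⇔-sym (D-fresh ((y , e) ∷ Γ) c))

  isCongruence : IsCongruence _≈_
  isCongruence = record
    { refl′    = λ A Γ c → ⇔-id _
    ; sym′     = λ A≈B Γ c → ⇔-sym (A≈B Γ c)
    ; trans′   = λ A≈B B≈C Γ c → B≈C Γ c ⇔-∘ A≈B Γ c
    ; lam-cong = lam-cong
    ; app-cong = λ {A} {B} {C} {D} A≈B C≈D Γ → app-resp A B C D (A≈B Γ) (C≈D Γ)
    }
    where
    lam-cong : ∀ {A B} x → A ≈ B → lam x A ≈ lam x B
    lam-cong x A≈B Γ (binder w) = ⇔-id _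
    lam-cong x A≈B Γ (e ↦ m)    = A≈B ((x , e) ∷ Γ) m

  β₁-sound : ∀ x D → app (lam x (var x)) D ≈ D
  β₁-sound x D Γ c = mk⇔ (λ (e , ds , l) → All.lookup ds (to Lookup-here l))
                         (λ d → c ∷ [] , d ∷ [] , from Lookup-here (here refl))

  β₂-sound : ∀ x y D → x ≢ y → app (lam x (var y)) D ≈ var y
  β₂-sound x y D x≢y Γ c = mk⇔ (λ (_ , _ , l) → to (Lookup-there x≢y) l)
                               (λ l → [] , [] , from (Lookup-there x≢y) l)

  β₃-sound : ∀ x A B D →
             app (lam x (app A B)) D ≈ app (app (lam x A) D) (app (lam x B) D)
  β₃-sound x A B D Γ c = mk⇔ distribute collect
    where
    distribute : ⟦ app (lam x (app A B)) D ⟧ Γ c →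
                 ⟦ app (app (lam x A) D) (app (lam x B) D) ⟧ Γ c
    distribute (e , ds , (e′ , bs , a)) = e′ , All.map (λ b → e , ds , b) bs , (e , ds , a)

    -- The arguments of the several B-calls are merged into one finite set,
    -- which suffices by monotonicity of the denotation in the environment.
    collect : ⟦ app (app (lam x A) D) (app (lam x B) D) ⟧ Γ c →
              ⟦ app (lam x (app A B)) D ⟧ Γ c
    collect (e′ , bs , (e , ds , a))
      with merge-witnesses (λ E c′ → ⟦ B ⟧ ((x , E) ∷ Γ) c′)
                           (λ E⊆E′ → ⟦⟧-mono B (⊑-∷ʳ x E⊆E′)) bs
    ... | E , dsE , bsE =
      e ++ E , ++⁺ ds dsE ,
      e′ , All.map (⟦⟧-mono B (⊑-∷ʳ x (xs⊆ys++xs E e))) bsE ,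
      ⟦⟧-mono A (⊑-∷ʳ x (xs⊆xs++ys e E)) a

  β₄-sound : ∀ x A D → app (lam x (lam x A)) D ≈ lam x A
  β₄-sound x A D Γ c = mk⇔ (λ (_ , _ , a) → to (lam-shadowed x A c) a)
                           (λ a → [] , [] , from (lam-shadowed x A c) a)

  β₅-sound : ∀ x y A D → x ≢ y → app (lam y D) (var x) ≈ D →
             app (lam x (lam y A)) D ≈ lam y (app (lam x A) D)
  β₅-sound x y A D x≢y D-fresh Γ (binder w) =
    mk⇔ (λ (_ , _ , w≡y) → w≡y) (λ w≡y → [] , [] , w≡y)
  β₅-sound x y A D x≢y D-fresh Γ (e′ ↦ m) =
    mk⇔ (λ (e , ds , a) → e , All.map (from D-irrelevant) ds , ⟦⟧-mono A (swap x≢y) a)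
        (λ (e , ds , a) → e , All.map (to D-irrelevant) ds , ⟦⟧-mono A (swap (≢-sym x≢y)) a)
    where
    D-irrelevant : ∀ {c} → ⟦ D ⟧ ((y , e′) ∷ Γ) c ⇔ ⟦ D ⟧ Γ c
    D-irrelevant {c} = binding-irrelevant D x≢y D-fresh e′ Γ c

  isPrelambdaCongruence : IsPrelambdaCongruence _≈_
  isPrelambdaCongruence = record
    { isCongruence = isCongruence
    ; β₁ = β₁-sound
    ; β₂ = β₂-sound
    ; β₃ = β₃-sound
    ; β₄ = β₄-sound
    ; β₅ = β₅-sound
    }

  id-binders-distinct : ∀ {x y} → x ≢ y → ¬ (lam x (var x) ≈ lam y (var y))
  id-binders-distinct {x} x≢y λxx≈λyy = x≢y (to (λxx≈λyy [] (binder x)) refl)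

theorem3p3 : (V : Set) → Infinite V → (x y : V) → ¬ (x ≡ y) →
    Σ (Term V → Term V → Set) (λ _∼_ →
    Σ (IsPrelambdaCongruence _∼_) (λ _ →
    ¬ (lam x (var x) ∼ lam y (var y))))
theorem3p3 V _ x y x≢y =
  _≈_ , isPrelambdaCongruence , id-binders-distinct x≢y
  where open Model V
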